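{- Fix positive integers $n$ and $k$. If there exists a valid dynamic task allocation $f_1^{n,k},\dots,f_n^{n,k}$ for $n$ agents and $k$ tasks with maximum switching cost $D$, then for every positive integer $k'<k$ there exists a valid dynamic task allocation $g_1^{n,k'},\dots,g_n^{n,k'}$ for $n$ agents and $k'$ tasks with maximum switching cost $D$.
   Context: A demand vector for $n$ agents and $k$ tasks is $\vec v=(v_1,\dots,v_k)$ of non-negative integers with $\sum_i v_i=n$. A valid dynamic task allocation is a family of functions $f_1^{n,k},\dots,f_n^{n,k}$ from demand vectors to $[k]$ such that for every $\vec v$ and every task $i$, exactly $v_i$ agents $a$ have $f_a^{n,k}(\vec v)=i$. Demand vectors are adjacent if their $\ell_1$ distance is $2$. The switching cost of a pair $(\vec v,\vec v')$ is the number of agents $a$ with $f_a^{n,k}(\vec v)\neq f_a^{n,k}(\vec v')$, and the maximum switching cost is the maximum over all adjacent pairs. -}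

module Defs where

open import Data.Nat using (ℕ; _≤_; ∣_-_∣)
open import Data.Fin using (Fin; _≟_)
open import Data.List using (length; filter)
open import Data.List.Base using (allFin)
open import Data.Vec.Functional using (Vector)
import Data.Vec.Functional as VF
open import Data.Product using (Σ; proj₁)
open import Relation.Binary.PropositionalEquality using (_≡_)
open import Relation.Nullary using (¬?)

sumF : ∀ {k} → (Fin k → ℕ) → ℕ
sumF = VF.foldr Data.Nat._+_ 0
  where import Data.Nat

DemandVec : ℕ → ℕ → Set
DemandVec n k = Σ (Fin k → ℕ) (λ v → sumF v ≡ n)

Allocation : ℕ → ℕ → Set
Allocation n k = Fin n → DemandVec n k → Fin k

numAssigned : ∀ {n k} → Allocation n k → DemandVec n k → Fin k → ℕ
numAssigned {n} f v i = length (filter (λ a → f a v ≟ i) (allFin n))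

Valid : ∀ {n k} → Allocation n k → Set
Valid {n} {k} f = (v : DemandVec n k) (i : Fin k) → numAssigned f v i ≡ proj₁ v i

l1dist : ∀ {k} → (Fin k → ℕ) → (Fin k → ℕ) → ℕ
l1dist v w = sumF (λ i → ∣ v i - w i ∣)

Adjacent : ∀ {n k} → DemandVec n k → DemandVec n k → Set
Adjacent v w = l1dist (proj₁ v) (proj₁ w) ≡ 2

switchingCost : ∀ {n k} → Allocation n k → DemandVec n k → DemandVec n k → ℕ
switchingCost {n} f v w = length (filter (λ a → ¬? (f a v ≟ f a w)) (allFin n))

MaxSwitchingCostAtMost : ∀ {n k} → Allocation n k → ℕ → Set
MaxSwitchingCostAtMost {n} {k} f D =
  (v w : DemandVec n k) → Adjacent v w → switchingCost f v w ≤ D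

-- From an allocation for k + 1 ≥ 2 tasks we get one for k tasks: prepend a task of demand zero,
-- run the given allocation, and move every agent from task i + 1 to task i. Validity forces
-- that no agent is assigned to the zero-demand task, so the demands are met exactly, and
-- agents keeping their task under f keep it under the new allocation, so switching costs
-- do not grow. Iterating this removes any number of tasks.
module Submission where

open import Defs
open import Data.Nat using (ℕ; suc; _<_; _≤_; s≤s; _≤′_; ≤′-refl; ≤′-step; NonZero)
open import Data.Nat.Properties using (≤-trans; <-irrefl; ≤⇒≤′)
open import Data.Fin using (Fin; _≟_)
open import Data.Fin.Properties using (suc-injective)
open import Data.List using (List; []; _∷_; length; filter)
open import Data.List.Base using (allFin)
open import Data.List.Properties using (filter-some; filter-accept; filter-reject)
open import Data.List.Relation.Unary.All using (All; []; _∷_)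
import Data.List.Relation.Unary.All as All
open import Data.List.Relation.Unary.All.Properties using (¬Any⇒All¬)
open import Data.List.Relation.Binary.Sublist.Propositional using (⊆-refl)
open import Data.List.Relation.Binary.Sublist.Propositional.Properties
  using (filter⁺; length-mono-≤)
open import Data.Product using (Σ; _×_; _,_; proj₁)
open import Function using (_∘_)
open import Level using (0ℓ)
open import Function.Bundles using (_⇔_; mk⇔; Equivalence)
open import Relation.Binary.PropositionalEquality
  using (_≡_; _≢_; refl; sym; trans; cong; subst; module ≡-Reasoning)
open import Relation.Nullary using (yes; no; ¬?)
open import Relation.Unary using (Pred; Decidable; ∁)

module _ {A : Set} {P Q : Pred A 0ℓ} (P? : Decidable P) (Q? : Decidable Q) where

  length-filter-mono : (∀ {x} → P x → Q x) → (xs : List A) →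
                       length (filter P? xs) ≤ length (filter Q? xs)
  length-filter-mono P⇒Q xs = length-mono-≤ (filter⁺ P? Q? (λ { refl → P⇒Q }) (⊆-refl {x = xs}))

  filter-cong-All : {xs : List A} → All (λ x → P x ⇔ Q x) xs → filter P? xs ≡ filter Q? xs
  filter-cong-All [] = refl
  filter-cong-All {x ∷ _} (Px⇔Qx ∷ rest) with P? x
  ... | yes Px = trans (cong (x ∷_) (filter-cong-All rest))
                       (sym (filter-accept Q? (Equivalence.to Px⇔Qx Px)))
  ... | no ¬Px = trans (filter-cong-All rest)
                       (sym (filter-reject Q? (λ Qx → ¬Px (Equivalence.from Px⇔Qx Qx))))

length-filter≡0⇒All∁ : ∀ {A : Set} {P : Pred A 0ℓ} (P? : Decidable P) (xs : List A) →
                       length (filter P? xs) ≡ 0 → All (∁ P) xs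
length-filter≡0⇒All∁ P? xs empty =
  ¬Any⇒All¬ xs (λ some → <-irrefl refl (subst (0 <_) empty (filter-some P? some)))

CostBoundedAllocation : ℕ → ℕ → ℕ → Set
CostBoundedAllocation n k D = Σ (Allocation n k) (λ f → Valid f × MaxSwitchingCostAtMost f D)

padDemand : ∀ {n k} → DemandVec n k → DemandVec n (suc k)
padDemand (v , Σv≡n) = (λ { Fin.zero → 0 ; (Fin.suc i) → v i }) , Σv≡n

padDemand-adjacent : ∀ {n k} {v w : DemandVec n k} →
                     Adjacent v w → Adjacent (padDemand v) (padDemand w)
padDemand-adjacent adjacent = adjacent

-- The value at zero is junk; it is never used, since no agent is sent to the padded task.
unshiftTask : ∀ {k} → Fin (suc (suc k)) → Fin (suc k)
unshiftTask Fin.zero    = Fin.zero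
unshiftTask (Fin.suc i) = i

unshiftTask≡⇔≡suc : ∀ {k} {t : Fin (suc (suc k))} {j : Fin (suc k)} →
                    t ≢ Fin.zero → (unshiftTask t ≡ j ⇔ t ≡ Fin.suc j)
unshiftTask≡⇔≡suc {t = Fin.zero}  t≢0 with () ← t≢0 refl
unshiftTask≡⇔≡suc {t = Fin.suc i} t≢0 = mk⇔ (cong Fin.suc) suc-injective

dropTask : ∀ {n k D} → CostBoundedAllocation n (suc (suc k)) D → CostBoundedAllocation n (suc k) D
dropTask {n} {k} {D} (f , valid , costBound) = g , validG , costBoundG
  where
  g : Allocation n (suc k)
  g a v = unshiftTask (f a (padDemand v))

  validG : Valid g
  validG v j = begin
      length (filter (λ a → g a v ≟ j) agents)
    ≡⟨ cong length (filter-cong-All (λ a → g a v ≟ j) (λ a → f a v′ ≟ Fin.suc j)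
                      (All.map unshiftTask≡⇔≡suc nobodyOnPad)) ⟩
      length (filter (λ a → f a v′ ≟ Fin.suc j) agents)
    ≡⟨ valid v′ (Fin.suc j) ⟩
      proj₁ v j
    ∎
    where
    open ≡-Reasoning
    agents = allFin n
    v′ = padDemand v
    nobodyOnPad : All (λ a → f a v′ ≢ Fin.zero) agents
    nobodyOnPad = length-filter≡0⇒All∁ (λ a → f a v′ ≟ Fin.zero) agents (valid v′ Fin.zero)

  costBoundG : MaxSwitchingCostAtMost g D
  costBoundG v w adjacent = ≤-trans
    (length-filter-mono (λ a → ¬? (g a v ≟ g a w))
                        (λ a → ¬? (f a (padDemand v) ≟ f a (padDemand w)))
                        (λ gDiffers fSame → gDiffers (cong unshiftTask fSame))
                        (allFin n))
    (costBound (padDemand v) (padDemand w) (padDemand-adjacent {v = v} {w} adjacent))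

dropTasks : ∀ {n D} k′ k → suc k′ ≤′ k → CostBoundedAllocation n (suc k) D →
            CostBoundedAllocation n (suc k′) D
dropTasks k′ .(suc k′) ≤′-refl        = dropTask
dropTasks k′ (suc k)   (≤′-step k′<k) = dropTasks k′ k k′<k ∘ dropTask

lemma13 : (n k : ℕ) → .{{NonZero n}} → .{{NonZero k}} → (D : ℕ) →
    Σ (Allocation n k) (λ f → Valid f × MaxSwitchingCostAtMost f D) →
    (k′ : ℕ) → .{{NonZero k′}} → k′ < k →
    Σ (Allocation n k′) (λ g → Valid g × MaxSwitchingCostAtMost g D)
lemma13 n (suc k) D allocation (suc k′) (s≤s k′<k) = dropTasks k′ k (≤⇒≤′ k′<k) allocation
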